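{- The relation $\preceq$ is a partial order on the set of all caterpillar sequences.
   Context: A caterpillar sequence is a finite sequence $S=(s_1,\dots,s_k)$, $k\ge1$, of non-negative integers with $s_1,s_k\ge1$, and $s_1\ge2$ if $k=1$. Define $f(S)=(s_1)$ if $k=1$ and $f(S)=(s_1+1,s_2+2,\dots,s_{k-1}+2,s_k+1)$ if $k>1$. For caterpillar sequences $S$ of length $k$ and $S'$ of length $k'$, write $S'\preceq S$ (caterpillar subsequence) if $1\le k'\le k$ and there exists $i\in\{0,\dots,k-k'\}$ with $f(S')[j]\le f(S)[j+i]$ for all $j\in\{1,\dots,k'\}$, where $a[j]$ denotes the $j$-th entry of a sequence $a$. -}

module Defs where

open import Data.Nat using (ℕ; zero; suc; _+_; _∸_; _≤_; _<_)
open import Data.List using (List; []; _∷_; length; last)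
open import Data.Maybe using (Maybe; just; nothing)
open import Data.Product using (Σ; ∃; _×_; _,_; proj₁)
open import Data.Sum using (_⊎_)
open import Relation.Binary.PropositionalEquality using (_≡_)

-- Entry at 0-based position j (0 if out of range; only used in range).
_!_ : List ℕ → ℕ → ℕ
[] ! _ = 0
(x ∷ xs) ! zero = x
(x ∷ xs) ! suc j = xs ! j

-- A caterpillar sequence (s₁,…,s_k): k ≥ 1, s₁ ≥ 1, s_k ≥ 1, and s₁ ≥ 2 if k = 1.
data IsCaterpillar : List ℕ → Set where
  single : ∀ {s} → 2 ≤ s → IsCaterpillar (s ∷ [])
  multi  : ∀ {s t ts} → 1 ≤ s → 1 ≤ (s ∷ t ∷ ts) ! (length (t ∷ ts)) →
           IsCaterpillar (s ∷ t ∷ ts)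

private
  inner : List ℕ → List ℕ
  inner [] = []
  inner (x ∷ []) = suc x ∷ []
  inner (x ∷ y ∷ ys) = suc (suc x) ∷ inner (y ∷ ys)

f : List ℕ → List ℕ
f [] = []
f (x ∷ []) = x ∷ []
f (x ∷ y ∷ ys) = suc x ∷ inner (y ∷ ys)

Caterpillar : Set
Caterpillar = Σ (List ℕ) IsCaterpillar

_≈ᶜ_ : Caterpillar → Caterpillar → Set
S' ≈ᶜ S = proj₁ S' ≡ proj₁ S

-- S' ⪯ S : 1 ≤ k' ≤ k and there is i ∈ {0,…,k-k'} with
-- f(S')[j] ≤ f(S)[j+i] for all j ∈ {1,…,k'}  (here 0-based indices).
_⪯_ : Caterpillar → Caterpillar → Set
(S' , _) ⪯ (S , _) =
  1 ≤ length S' × length S' ≤ length S ×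
  ∃ λ i → i ≤ length S ∸ length S' ×
    (∀ j → j < length S' → f S' ! j ≤ f S ! (j + i))

-- Reflexivity and transitivity hold because offsets add up.  For antisymmetry,
-- S' ⪯ S ⪯ S' forces equal lengths and hence offset 0, so f(S') and f(S)
-- agree entrywise; f only shifts entries by amounts depending on the position,
-- so it is injective on sequences of equal length, and S' = S.
module Submission where

open import Defs
open import Relation.Binary.Structures using (IsPartialOrder)
open import Data.Nat using (ℕ; suc; _+_; _∸_; _≤_; _<_; z≤n; s≤s)
open import Data.Nat.Properties
open import Data.List using (List; []; _∷_; length)
open import Data.List.Properties using (∷-injective)
open import Data.Product using (_,_)
open import Relation.Binary.PropositionalEquality

bumpHead : List ℕ → List ℕ
bumpHead []       = []
bumpHead (x ∷ xs) = suc x ∷ xs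

bumpHead-injective : ∀ {xs ys} → bumpHead xs ≡ bumpHead ys → xs ≡ ys
bumpHead-injective {[]}    {[]}    _  = refl
bumpHead-injective {_ ∷ _} {_ ∷ _} eq with ∷-injective eq
... | x≡y , xs≡ys = cong₂ _∷_ (suc-injective x≡y) xs≡ys

length-bumpHead : ∀ xs → length (bumpHead xs) ≡ length xs
length-bumpHead []      = refl
length-bumpHead (_ ∷ _) = refl

f-∷-∷ : ∀ x y ys → f (x ∷ y ∷ ys) ≡ suc x ∷ bumpHead (f (y ∷ ys))
f-∷-∷ x y []      = refl
f-∷-∷ x y (_ ∷ _) = refl

length-f : ∀ xs → length (f xs) ≡ length xs
length-f []           = refl
length-f (_ ∷ [])     = refl
length-f (x ∷ y ∷ ys) = begin
  length (f (x ∷ y ∷ ys))                   ≡⟨ cong length (f-∷-∷ x y ys) ⟩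
  suc (length (bumpHead (f (y ∷ ys))))      ≡⟨ cong suc (length-bumpHead (f (y ∷ ys))) ⟩
  suc (length (f (y ∷ ys)))                 ≡⟨ cong suc (length-f (y ∷ ys)) ⟩
  length (x ∷ y ∷ ys)                       ∎
  where open ≡-Reasoning

f-injective : ∀ {xs ys} → length xs ≡ length ys → f xs ≡ f ys → xs ≡ ys
f-injective {[]}         {[]}         _   _  = refl
f-injective {_ ∷ []}     {_ ∷ []}     _   eq = eq
f-injective {x ∷ y ∷ xs} {x' ∷ y' ∷ ys} len eq =
  let heads , tails = ∷-injective (trans (sym (f-∷-∷ x y xs)) (trans eq (f-∷-∷ x' y' ys)))
  in cong₂ _∷_ (suc-injective heads)
               (f-injective {y ∷ xs} {y' ∷ ys} (suc-injective len) (bumpHead-injective tails))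

!-extensional : ∀ {xs ys} → length xs ≡ length ys →
                (∀ j → j < length xs → xs ! j ≡ ys ! j) → xs ≡ ys
!-extensional {[]}     {[]}     _   _  = refl
!-extensional {x ∷ xs} {y ∷ ys} len eq =
  cong₂ _∷_ (eq 0 (s≤s z≤n))
            (!-extensional (suc-injective len) λ j j< → eq (suc j) (s≤s j<))

length-caterpillar-positive : ∀ {S} → IsCaterpillar S → 1 ≤ length S
length-caterpillar-positive (single _)  = s≤s z≤n
length-caterpillar-positive (multi _ _) = s≤s z≤n

⪯-reflexive : ∀ {S' S} → S' ≈ᶜ S → S' ⪯ S
⪯-reflexive {S , isCat} refl =
  length-caterpillar-positive isCat , ≤-refl , 0 , z≤n ,
  λ j _ → ≤-reflexive (cong (f S !_) (sym (+-identityʳ j)))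

⪯-trans : ∀ {S'' S' S} → S'' ⪯ S' → S' ⪯ S → S'' ⪯ S
⪯-trans {A , _} {B , _} {C , _} (1≤a , a≤b , i , i≤ , A≤B) (_ , b≤c , i' , i'≤ , B≤C) =
  1≤a , ≤-trans a≤b b≤c , i + i' , m+n≤o⇒m≤o∸n (i + i') i+i'+a≤c ,
  λ j j< → begin
    f A ! j               ≤⟨ A≤B j j< ⟩
    f B ! (j + i)         ≤⟨ B≤C (j + i) (shifted-in-range j<) ⟩
    f C ! (j + i + i')    ≡⟨ cong (f C !_) (+-assoc j i i') ⟩
    f C ! (j + (i + i'))  ∎
  where
  open ≤-Reasoning
  a = length A
  b = length B
  c = length C
  i+a≤b : i + a ≤ b
  i+a≤b = m≤o∸n⇒m+n≤o i a≤b i≤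
  i'+b≤c : i' + b ≤ c
  i'+b≤c = m≤o∸n⇒m+n≤o i' b≤c i'≤
  shifted-in-range : ∀ {j} → j < a → j + i < b
  shifted-in-range {j} j<a = begin-strict
    j + i  <⟨ +-monoˡ-< i j<a ⟩
    a + i  ≡⟨ +-comm a i ⟩
    i + a  ≤⟨ i+a≤b ⟩
    b      ∎
  i+i'+a≤c : i + i' + a ≤ c
  i+i'+a≤c = begin
    i + i' + a    ≡⟨ +-assoc i i' a ⟩
    i + (i' + a)  ≡⟨ cong (i +_) (+-comm i' a) ⟩
    i + (a + i')  ≡⟨ sym (+-assoc i a i') ⟩
    i + a + i'    ≤⟨ +-monoˡ-≤ i' i+a≤b ⟩
    b + i'        ≡⟨ +-comm b i' ⟩
    i' + b        ≤⟨ i'+b≤c ⟩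
    c             ∎

offset-zero : ∀ {i m n} → m ≡ n → i ≤ n ∸ m → i ≡ 0
offset-zero {m = m} refl i≤ = n≤0⇒n≡0 (≤-trans i≤ (≤-reflexive (n∸n≡0 m)))

⪯-antisym : ∀ {S' S} → S' ⪯ S → S ⪯ S' → S' ≈ᶜ S
⪯-antisym {A , _} {B , _} (_ , a≤b , i , i≤ , A≤B) (_ , b≤a , i' , i'≤ , B≤A) =
  f-injective a≡b (!-extensional fa≡fb entries-equal)
  where
  a≡b : length A ≡ length B
  a≡b = ≤-antisym a≤b b≤a
  fa≡fb : length (f A) ≡ length (f B)
  fa≡fb = trans (length-f A) (trans a≡b (sym (length-f B)))
  entries-equal : ∀ j → j < length (f A) → f A ! j ≡ f B ! j
  entries-equal j j<fa with offset-zero a≡b i≤ | offset-zero (sym a≡b) i'≤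
  ... | refl | refl = ≤-antisym
    (subst (λ k → f A ! j ≤ f B ! k) (+-identityʳ j) (A≤B j j<a))
    (subst (λ k → f B ! j ≤ f A ! k) (+-identityʳ j) (B≤A j (subst (j <_) a≡b j<a)))
    where
    j<a : j < length A
    j<a = subst (j <_) (length-f A) j<fa

proposition2 : IsPartialOrder _≈ᶜ_ _⪯_
proposition2 = record
  { isPreorder = record
    { isEquivalence = record { refl = refl ; sym = sym ; trans = trans }
    ; reflexive     = λ {S'} {S} → ⪯-reflexive {S'} {S}
    ; trans         = λ {S''} {S'} {S} → ⪯-trans {S''} {S'} {S}
    }
  ; antisym = λ {S'} {S} → ⪯-antisym {S'} {S}
  }
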